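{- Let $(\Psi,\vec u,E)$ be a gcd-to-div triple in which $\Psi$ has $d$ variables, and let $p\in\mathbb{P}(\Psi)$. If $\Psi$ has a solution modulo $p$, then it has a solution $\vec b_p\in\mathbb{Z}^d$ modulo $p$ with $\|\vec b_p\|_\infty\le(d+1)\cdot\|\Psi\|_\infty^3\,p^2$.
   Context: Divisibility $m\mid n$ of integers holds iff $n=qm$ for a unique $q\in\mathbb{Z}$. A system of divisibility constraints $\Psi=\bigwedge_{i=1}^m f_i\mid g_i$ has linear polynomials $f_i\ne0$, $g_i$ with integer coefficients and constants. For a prime $p$, $v_p(a)$ is the exponent of $p$ in $a\ne0$, $v_p(0)=\infty$; $\vec b$ is a solution of $\Psi$ modulo $p$ if $f_i(\vec b)\ne0$ and $v_p(f_i(\vec b))\le v_p(g_i(\vec b))$ for all $i$. $\mathbb{P}(\Psi)$ is the set of primes $p$ with $p\le m$ or $p$ dividing a coefficient or constant of some $f_i$. $\|\Psi\|_\infty$ is the maximum absolute value of a coefficient or constant of a polynomial of $\Psi$. A triple $(\Psi,\vec u,E)$ is a gcd-to-div triple if there are $d',m'\in\mathbb{N}$ and three disjoint families of variables $\vec z,\vec y,\vec w$ such that: (1) $\Psi(\vec z,\vec y,\vec w)$ is a system of divisibility constraints in $m'$ variables, $\vec u\in\mathbb{Z}^{d'}$, $E\in\mathbb{Z}^{d'\times m'}$ with each column corresponding to a variable of $\Psi$; (2) each divisibility in $\Psi$ has the form $h(\vec z)\mid f(\vec y)$ or $f(\vec y)\mid g(\vec w)$ with $g$ non-constant, every polynomial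 has only non-negative coefficients and constants, and every left-hand side has a strictly positive constant; (3) each variable $z$ of $\vec z$ appears in a single polynomial of $\Psi$, of the form $z+c$ with $c$ a positive integer, occurring in precisely two divisibilities (as left-hand side); (4) each variable $w$ of $\vec w$ appears in exactly two polynomials, $w$ and $w+c$ with $c$ a positive integer, each occurring in $\Psi$ exactly once (as right-hand sides); (5) every column of $E$ corresponding to a variable in $\vec z$ or $\vec w$ is zero. -}

module Defs where

open import Data.Nat as ℕ using (ℕ; zero; suc; _⊔_)
open import Data.Integer as ℤ using (ℤ; +_; ∣_∣)
open import Data.Integer.Divisibility using () renaming (_∣_ to _∣ℤ_)
open import Data.Fin using (Fin; zero; suc)
open import Data.Vec using (Vec; []; _∷_; lookup; tabulate; foldr)
open import Data.Bool using (if_then_else_)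
open import Data.Product using (Σ; _×_; ∃; ∃-syntax)
open import Data.Sum using (_⊎_)
open import Relation.Nullary using (¬_; does)
open import Relation.Binary.PropositionalEquality using (_≡_; _≢_)
import Data.Fin as Fin

record Lin (d : ℕ) : Set where
  constructor mkLin
  field
    coeffs : Vec ℤ d
    const  : ℤ
open Lin public

coeff : ∀ {d} → Lin d → Fin d → ℤ
coeff f k = lookup (coeffs f) k

dot : ∀ {d} → Vec ℤ d → Vec ℤ d → ℤ
dot []       []       = + 0
dot (a ∷ as) (b ∷ bs) = a ℤ.* b ℤ.+ dot as bs

eval : ∀ {d} → Lin d → Vec ℤ d → ℤ
eval f b = dot (coeffs f) b ℤ.+ const f

IsZeroPoly : ∀ {d} → Lin d → Set
IsZeroPoly f = (∀ k → coeff f k ≡ + 0) × const f ≡ + 0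

varPlus : ∀ {d} → Fin d → ℤ → Lin d
varPlus j c = mkLin (tabulate (λ k → if does (k Fin.≟ j) then + 1 else + 0)) c

-- Systems of divisibility constraints  ⋀_{i<m} f_i ∣ g_i  in d variables

record System (d : ℕ) : Set where
  field
    m        : ℕ
    lhs      : Fin m → Lin d
    rhs      : Fin m → Lin d
    lhs≢0    : ∀ i → ¬ IsZeroPoly (lhs i)
open System public

-- p-adic valuation, with v_p(0) = ∞.
-- HasVal p a k  :  a ≠ 0 and v_p(a) = k, i.e. p^k ∣ a and p^(k+1) ∤ a.

HasVal : ℕ → ℤ → ℕ → Set
HasVal p a k = (+ (p ℕ.^ k) ∣ℤ a) × ¬ (+ (p ℕ.^ suc k) ∣ℤ a)

-- v_p(a) ≤ v_p(b) for a ≠ 0 (with v_p(0) = ∞)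
ValLe : ℕ → ℤ → ℤ → Set
ValLe p a b = ∀ k → HasVal p a k → (b ≡ + 0) ⊎ (∃[ k' ] (HasVal p b k' × k ℕ.≤ k'))

SolModP : ∀ {d} → System d → ℕ → Vec ℤ d → Set
SolModP Ψ p b = ∀ i → (eval (lhs Ψ i) b ≢ + 0) × ValLe p (eval (lhs Ψ i) b) (eval (rhs Ψ i) b)

-- ℙ(Ψ): primes p with p ≤ m, or p dividing a (nonzero) coefficient or
-- constant of some left-hand side f_i.  (Primality is a separate
-- hypothesis in the statement.)

InPΨ : ∀ {d} → System d → ℕ → Set
InPΨ Ψ p =
  (p ℕ.≤ m Ψ)
  ⊎ (∃[ i ] ((∃[ k ] (coeff (lhs Ψ i) k ≢ + 0 × (+ p ∣ℤ coeff (lhs Ψ i) k)))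
             ⊎ (const (lhs Ψ i) ≢ + 0 × (+ p ∣ℤ const (lhs Ψ i)))))

normLin : ∀ {d} → Lin d → ℕ
normLin f = foldr (λ _ → ℕ) (λ a r → ∣ a ∣ ⊔ r) ∣ const f ∣ (coeffs f)

maxFin : ∀ {n} → (Fin n → ℕ) → ℕ
maxFin {zero}  g = 0
maxFin {suc n} g = g zero ⊔ maxFin (λ i → g (suc i))

normSys : ∀ {d} → System d → ℕ
normSys Ψ = maxFin (λ i → normLin (lhs Ψ i) ⊔ normLin (rhs Ψ i))

NormLe : ∀ {d} → Vec ℤ d → ℕ → Set
NormLe b B = ∀ k → ∣ lookup b k ∣ ℕ.≤ B

data VarKind : Set where
  Z Y W : VarKind

OnlyKind : ∀ {d} → (Fin d → VarKind) → VarKind → Lin d → Set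
OnlyKind kind K f = ∀ k → kind k ≢ K → coeff f k ≡ + 0

NonConstant : ∀ {d} → Lin d → Set
NonConstant f = ∃[ k ] (coeff f k ≢ + 0)

NonNeg : ∀ {d} → Lin d → Set
NonNeg f = (∀ k → + 0 ℤ.≤ coeff f k) × (+ 0 ℤ.≤ const f)

ExactlyOne : ∀ {m} → (Fin m → Set) → Set
ExactlyOne P = ∃[ i ] (P i × (∀ j → P j → j ≡ i))

ExactlyTwo : ∀ {m} → (Fin m → Set) → Set
ExactlyTwo P = ∃[ i ] ∃[ j ] (i ≢ j × P i × P j × (∀ k → P k → (k ≡ i ⊎ k ≡ j)))

-- conditions (2)–(5) for a given partition of the variables into z, y, w
record GcdToDivConds {d d' : ℕ} (Ψ : System d) (u : Vec ℤ d') (E : Vec (Vec ℤ d) d')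
                     (kind : Fin d → VarKind) : Set where
  field
    shape    : ∀ i → (OnlyKind kind Z (lhs Ψ i) × OnlyKind kind Y (rhs Ψ i))
                   ⊎ (OnlyKind kind Y (lhs Ψ i) × OnlyKind kind W (rhs Ψ i)
                       × NonConstant (rhs Ψ i))
    lhsNonNeg : ∀ i → NonNeg (lhs Ψ i)
    rhsNonNeg : ∀ i → NonNeg (rhs Ψ i)
    lhsPos    : ∀ i → + 0 ℤ.< const (lhs Ψ i)
    zVars : ∀ z → kind z ≡ Z → ∃[ c ] ((+ 0 ℤ.< c)
              × (∀ i → coeff (lhs Ψ i) z ≢ + 0 → lhs Ψ i ≡ varPlus z c)
              × (∀ i → coeff (rhs Ψ i) z ≡ + 0)
              × ExactlyTwo (λ i → lhs Ψ i ≡ varPlus z c))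
    wVars : ∀ w → kind w ≡ W → ∃[ c ] ((+ 0 ℤ.< c)
              × (∀ i → coeff (lhs Ψ i) w ≡ + 0)
              × (∀ i → coeff (rhs Ψ i) w ≢ + 0 →
                       (rhs Ψ i ≡ varPlus w (+ 0)) ⊎ (rhs Ψ i ≡ varPlus w c))
              × ExactlyOne (λ i → rhs Ψ i ≡ varPlus w (+ 0))
              × ExactlyOne (λ i → rhs Ψ i ≡ varPlus w c))
    eCols : ∀ k → kind k ≢ Y → ∀ r → lookup (lookup E r) k ≡ + 0

-- (Ψ, u, E) is a gcd-to-div triple (d' = length of u, m' = d = #variables of Ψ)
IsGcdToDiv : ∀ {d d'} → System d → Vec ℤ d' → Vec (Vec ℤ d) d' → Set
IsGcdToDiv Ψ u E = ∃[ kind ] GcdToDivConds Ψ u E kind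

{-# OPTIONS --safe #-}
-- Starting from a solution b modulo p, each group of variables is moved to a small value.
-- A variable z occurs only in left-hand sides z + c, so z := 1 − c turns them into 1.
-- Each y is reduced modulo M = p^K, where ‖Ψ‖∞ < M ≤ p‖Ψ‖∞ + 1: every left-hand side in the
-- y's changes by a multiple of M, and every valuation that has to be preserved is bounded by
-- that of a nonzero constant of absolute value below M, i.e. is below K, where p-adic
-- valuations only depend on the residue modulo M.  A variable w occurs only as the right-hand
-- sides w and w + c of two divisibilities a₀ ∣ w and a₁ ∣ w + c; the smaller of v_p(a₀) and
-- v_p(a₁) is at most v_p(c), so w := −c (when v_p(a₀) ≤ v_p(a₁)) or w := 0 keeps the
-- corresponding divisibility and makes the other right-hand side vanish.  All coordinates of
-- the new solution are then bounded by p‖Ψ‖∞.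

module Submission where

open import Defs
open import Data.Nat using (ℕ; suc; _*_; _^_)
open import Data.Nat.Primality using (Prime)
open import Data.Integer using (ℤ)
open import Data.Vec using (Vec)
open import Data.Product using (Σ; _×_; ∃; ∃-syntax)

open import Data.Nat.Base as ℕ using (zero; z≤n; s≤s; _≤_; _<_; _⊔_; _∸_; NonZero; ≢-nonZero; >-nonZero; nonTrivial⇒n>1)
open import Data.Nat.Properties
  using (≤-refl; ≤-reflexive; ≤-trans; <⇒≤; <⇒≱; ≮⇒≥; ≰⇒>; ≤-<-trans; <-≤-trans; ≤∧≢⇒<; n<1+n; n≤1+n;
         m<1+n⇒m≤n; m∸n+n≡m; m≤m⊔n; m≤n⊔m; m≤m*n; m≤n*m; m<m*n; *-mono-≤; *-monoʳ-≤; *-assoc; *-comm;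
         ^-monoʳ-≤; ^-monoʳ-<; ^-distribˡ-+-*; m^n≢0; _≟_; _≤?_; module ≤-Reasoning)
open import Data.Nat.Divisibility using (_∣_; _∣?_; divides; ∣-trans; _∣0; 1∣_; ∣1⇒≡1; ∣⇒≤)
open import Data.Nat.Primality using (prime⇒nonTrivial)
open import Data.Integer.Base using (+_; -_; _+_; _-_; ∣_∣; +≤+; +<+; _%ℕ_; _/ℕ_)
  renaming (_*_ to _*ℤ_; _≤_ to _≤ℤ_; _<_ to _<ℤ_)
open import Data.Integer.Properties as ℤ using (∣-i∣≡∣i∣; ∣i∣≡0⇒i≡0; +-identityʳ; pos-*)
open import Data.Integer.DivMod using (a≡a%ℕn+[a/ℕn]*n; n%ℕd<d)
open import Data.Integer.Divisibility.Signed as Signed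
  using (∣ᵤ⇒∣; ∣⇒∣ᵤ; ∣m⇒∣-m; ∣m∣n⇒∣m+n; ∣m+n∣m⇒∣n; ∣m+n∣n⇒∣m; ∣n⇒∣m*n)
open import Data.Integer.Solver using (module +-*-Solver)
open import Data.Fin as Fin using (Fin; zero; suc)
open import Data.Fin.Properties using (any?; suc-injective)
open import Data.Vec using ([]; _∷_; lookup; tabulate; foldr)
open import Data.Vec.Properties using (lookup∘tabulate)
open import Data.Bool using (if_then_else_)
open import Data.Product using (_,_; proj₁; proj₂)
open import Data.Sum using (_⊎_; inj₁; inj₂; map₂)
open import Relation.Nullary using (yes; no; does; ¬?; contradiction)
open import Relation.Nullary.Decidable using (decidable-stable)
open import Relation.Binary.Definitions using (DecidableEquality)
open import Relation.Binary.PropositionalEquality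
  using (_≡_; _≢_; refl; sym; trans; cong; cong₂; subst; module ≡-Reasoning)

open +-*-Solver using (solve; _:+_; _:-_; _:*_; :-_; _:=_; con)

infix 4 _≡_mod_

record _≡_mod_ (a b : ℤ) (q : ℕ) : Set where
  constructor ≡-mod
  field q∣a-b : + q Signed.∣ a - b
open _≡_mod_

≡-mod-sym : ∀ {a b q} → a ≡ b mod q → b ≡ a mod q
≡-mod-sym {a} {b} (≡-mod q∣a-b) =
  ≡-mod (subst (_ Signed.∣_) (solve 2 (λ a b → :- (a :- b) := b :- a) refl a b) (∣m⇒∣-m q∣a-b))

∣-resp-≡-mod : ∀ {r q a b} → r ∣ q → a ≡ b mod q → r ∣ ∣ b ∣ → r ∣ ∣ a ∣
∣-resp-≡-mod {r} {q} {a} {b} r∣q (≡-mod q∣a-b) r∣b =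
  ∣⇒∣ᵤ {+ r} {a} (∣m+n∣n⇒∣m (Signed.∣-trans (∣ᵤ⇒∣ {+ r} {+ q} r∣q) q∣a-b) (∣m⇒∣-m (∣ᵤ⇒∣ {+ r} {b} r∣b)))

∣-offset : ∀ {r x c} → r ∣ ∣ x ∣ → r ∣ ∣ x + c ∣ → r ∣ ∣ c ∣
∣-offset {r} {x} {c} r∣x r∣x+c =
  ∣⇒∣ᵤ {+ r} {c} (∣m+n∣m⇒∣n (∣ᵤ⇒∣ {+ r} {x + c} r∣x+c) (∣ᵤ⇒∣ {+ r} {x} r∣x))

∣∣-nonZero : ∀ {a} → a ≢ + 0 → NonZero ∣ a ∣
∣∣-nonZero a≢0 = ≢-nonZero (λ ∣a∣≡0 → a≢0 (∣i∣≡0⇒i≡0 ∣a∣≡0))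

>0⇒≢0 : ∀ {a} → + 0 <ℤ a → a ≢ + 0
>0⇒≢0 a>0 a≡0 = ℤ.<⇒≢ a>0 (sym a≡0)

-- p-adic valuations, for a base p > 1

module Valuation {p : ℕ} (1<p : 1 < p) where

  instance
    p≢0 : NonZero p
    p≢0 = >-nonZero (<⇒≤ 1<p)

  pow-∣-pow : ∀ {i j} → i ≤ j → p ^ i ∣ p ^ j
  pow-∣-pow {i} {j} i≤j = divides (p ^ (j ∸ i)) (begin
    p ^ j               ≡⟨ cong (p ^_) (sym (m∸n+n≡m i≤j)) ⟩
    p ^ (j ∸ i ℕ.+ i)   ≡⟨ ^-distribˡ-+-* p (j ∸ i) i ⟩
    p ^ (j ∸ i) * p ^ i ∎)
    where open ≡-Reasoning

  n<p^n : ∀ n → n < p ^ n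
  n<p^n zero    = ≤-refl
  n<p^n (suc n) = ≤-<-trans (n<p^n n) (^-monoʳ-< p 1<p (n<1+n n))

  ^-cancelʳ-< : ∀ {i j} → p ^ i < p ^ j → i < j
  ^-cancelʳ-< pⁱ<pʲ = ≰⇒> (λ j≤i → <⇒≱ pⁱ<pʲ (^-monoʳ-≤ p j≤i))

  power-above : ∀ N → ∃[ K ] (N < p ^ K × p ^ K ≤ suc (p * N))
  power-above zero = 0 , ≤-refl , s≤s z≤n
  power-above (suc N) with power-above N
  ... | K , N<pᴷ , pᴷ≤ with suc N ≟ p ^ K
  ...   | no  N+1≢pᴷ = K , ≤∧≢⇒< N<pᴷ N+1≢pᴷ , ≤-trans pᴷ≤ (s≤s (*-monoʳ-≤ p (n≤1+n N)))
  ...   | yes N+1≡pᴷ = suc K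
                     , subst (λ t → suc N < p * t) N+1≡pᴷ N+1<p*[N+1]
                     , subst (λ t → p * t ≤ suc (p * suc N)) N+1≡pᴷ (n≤1+n _)
    where
    N+1<p*[N+1] : suc N < p * suc N
    N+1<p*[N+1] = subst (suc N <_) (*-comm (suc N) p) (m<m*n (suc N) p 1<p)

  valuation-or-pow∣ : ∀ a j → ∃ (HasVal p a) ⊎ p ^ j ∣ ∣ a ∣
  valuation-or-pow∣ a zero = inj₂ (1∣ ∣ a ∣)
  valuation-or-pow∣ a (suc j) with valuation-or-pow∣ a j
  ... | inj₁ val = inj₁ val
  ... | inj₂ pʲ∣a with p ^ suc j ∣? ∣ a ∣
  ...   | yes pʲ⁺¹∣a = inj₂ pʲ⁺¹∣a
  ...   | no  pʲ⁺¹∤a = inj₁ (j , pʲ∣a , pʲ⁺¹∤a)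

  valuation : ∀ {a} → a ≢ + 0 → ∃ (HasVal p a)
  valuation {a} a≢0 with valuation-or-pow∣ a ∣ a ∣
  ... | inj₁ val       = val
  ... | inj₂ p^∣a∣∣a = contradiction (∣⇒≤ {{∣∣-nonZero a≢0}} p^∣a∣∣a) (<⇒≱ (n<p^n ∣ a ∣))

  ≤-valuation : ∀ {a v j} → HasVal p a v → p ^ j ∣ ∣ a ∣ → j ≤ v
  ≤-valuation (_ , pᵛ⁺¹∤a) pʲ∣a = ≮⇒≥ (λ v<j → pᵛ⁺¹∤a (∣-trans (pow-∣-pow v<j) pʲ∣a))

  pow∣small⇒< : ∀ {c K j} → c ≢ + 0 → ∣ c ∣ < p ^ K → p ^ j ∣ ∣ c ∣ → j < K
  pow∣small⇒< c≢0 c<pᴷ pʲ∣c = ^-cancelʳ-< (≤-<-trans (∣⇒≤ {{∣∣-nonZero c≢0}} pʲ∣c) c<pᴷ)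

  -- v_p(a) ≤ v_p(b), without computing valuations
  record PowDivides (a b : ℤ) : Set where
    constructor powDivides
    field pow∣ : ∀ j → p ^ j ∣ ∣ a ∣ → p ^ j ∣ ∣ b ∣
  open PowDivides

  hasVal⇒powDivides : ∀ {a b} v → HasVal p a v → p ^ v ∣ ∣ b ∣ → PowDivides a b
  hasVal⇒powDivides {a} v val pᵛ∣b =
    powDivides (λ j pʲ∣a → ∣-trans (pow-∣-pow (≤-valuation {a} {v} {j} val pʲ∣a)) pᵛ∣b)

  powDivides⇒ValLe : ∀ {a b} → PowDivides a b → ValLe p a b
  powDivides⇒ValLe {b = b} a≼b k (pᵏ∣a , _) with b ℤ.≟ + 0
  ... | yes b≡0 = inj₁ b≡0
  ... | no  b≢0 with valuation b≢0
  ...   | k′ , val = inj₂ (k′ , val , ≤-valuation {b} {k′} {k} val (pow∣ a≼b k pᵏ∣a))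

  ValLe⇒powDivides : ∀ {a b} → a ≢ + 0 → ValLe p a b → PowDivides a b
  ValLe⇒powDivides a≢0 a≤b with valuation a≢0
  ... | v , val with a≤b v val
  ...   | inj₁ refl                         = powDivides (λ j _ → (p ^ j) ∣0)
  ...   | inj₂ (k′ , (pᵏ′∣b , _) , v≤k′) = hasVal⇒powDivides v val (∣-trans (pow-∣-pow v≤k′) pᵏ′∣b)

  powDivides-one : ∀ b → PowDivides (+ 1) b
  powDivides-one b = powDivides (λ j pʲ∣1 → subst (_∣ ∣ b ∣) (sym (∣1⇒≡1 pʲ∣1)) (1∣ ∣ b ∣))

  powDivides-zero : ∀ a → PowDivides a (+ 0)
  powDivides-zero a = powDivides (λ j _ → (p ^ j) ∣0)

  powDivides-resp-∣∣ : ∀ {a b c} → ∣ b ∣ ≡ ∣ c ∣ → PowDivides a b → PowDivides a c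
  powDivides-resp-∣∣ ∣b∣≡∣c∣ a≼b = powDivides (λ j pʲ∣a → subst (p ^ j ∣_) ∣b∣≡∣c∣ (pow∣ a≼b j pʲ∣a))

  powDivides-resp-rhs : ∀ {K c g g′} → c ≢ + 0 → ∣ c ∣ < p ^ K → g′ ≡ g mod p ^ K →
                        PowDivides c g → PowDivides c g′
  powDivides-resp-rhs {K} {c} c≢0 c<pᴷ g′≡g c≼g = powDivides (λ j pʲ∣c →
    ∣-resp-≡-mod (pow-∣-pow (<⇒≤ (pow∣small⇒< {c} {K} {j} c≢0 c<pᴷ pʲ∣c))) g′≡g (pow∣ c≼g j pʲ∣c))

  -- v_p(a) ≤ v_p(c) < K, and a valuation below K is determined by a modulo p^K.
  powDivides-resp-lhs : ∀ {K a a′ c} → a ≢ + 0 → c ≢ + 0 → ∣ c ∣ < p ^ K → a′ ≡ a mod p ^ K →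
                        PowDivides a c → PowDivides a′ c
  powDivides-resp-lhs {K} {a} {a′} {c} a≢0 c≢0 c<pᴷ a′≡a a≼c with valuation a≢0
  ... | v , (pᵛ∣a , pᵛ⁺¹∤a) = powDivides (λ j pʲ∣a′ → ∣-trans (pow-∣-pow (j≤v j pʲ∣a′)) (pow∣ a≼c v pᵛ∣a))
    where
    v<K : v < K
    v<K = pow∣small⇒< {c} {K} {v} c≢0 c<pᴷ (pow∣ a≼c v pᵛ∣a)
    j≤v : ∀ j → p ^ j ∣ ∣ a′ ∣ → j ≤ v
    j≤v j pʲ∣a′ = ≮⇒≥ (λ v<j → pᵛ⁺¹∤a
      (∣-resp-≡-mod (pow-∣-pow v<K) (≡-mod-sym a′≡a) (∣-trans (pow-∣-pow v<j) pʲ∣a′)))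

  pow∣-offset : ∀ {a a′ v v′ u x c} → HasVal p a v → HasVal p a′ v′ → u ≤ v → u ≤ v′ →
                PowDivides a x → PowDivides a′ (x + c) → p ^ u ∣ ∣ c ∣
  pow∣-offset {v = v} {v′} {x = x} {c} (pᵛ∣a , _) (pᵛ′∣a′ , _) u≤v u≤v′ a≼x a′≼x+c =
    ∣-offset {x = x} {c} (∣-trans (pow-∣-pow u≤v) (pow∣ a≼x v pᵛ∣a)) (∣-trans (pow-∣-pow u≤v′) (pow∣ a′≼x+c v′ pᵛ′∣a′))

dot-zeroˡ : ∀ {n} (a x : Vec ℤ n) → (∀ k → lookup a k ≡ + 0) → dot a x ≡ + 0
dot-zeroˡ []       []       _   = refl
dot-zeroˡ (a ∷ as) (y ∷ ys) a≡0 =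
  cong₂ (λ a s → a *ℤ y + s) (a≡0 zero) (dot-zeroˡ as ys (λ k → a≡0 (suc k)))

dot-indicator : ∀ {n} (j : Fin n) (f : Fin n → ℤ) (x : Vec ℤ n) →
                f j ≡ + 1 → (∀ k → k ≢ j → f k ≡ + 0) → dot (tabulate f) x ≡ lookup x j
dot-indicator zero f (y ∷ ys) fj≡1 f≡0 = begin
  f zero *ℤ y + dot (tabulate (λ k → f (suc k))) ys
    ≡⟨ cong₂ (λ a s → a *ℤ y + s) fj≡1
         (dot-zeroˡ (tabulate (λ k → f (suc k))) ys (λ k → trans (lookup∘tabulate _ k) (f≡0 (suc k) (λ ())))) ⟩
  + 1 *ℤ y + + 0 ≡⟨ trans (+-identityʳ _) (ℤ.*-identityˡ y) ⟩
  y              ∎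
  where open ≡-Reasoning
dot-indicator (suc j) f (y ∷ ys) fj≡1 f≡0 = begin
  f zero *ℤ y + dot (tabulate (λ k → f (suc k))) ys
    ≡⟨ cong₂ (λ a s → a *ℤ y + s) (f≡0 zero (λ ()))
         (dot-indicator j _ ys fj≡1 (λ k k≢j → f≡0 (suc k) (λ e → k≢j (suc-injective e)))) ⟩
  + 0 *ℤ y + lookup ys j ≡⟨ ℤ.+-identityˡ _ ⟩
  lookup ys j            ∎
  where open ≡-Reasoning

eval-varPlus : ∀ {d} (j : Fin d) c (x : Vec ℤ d) → eval (varPlus j c) x ≡ lookup x j + c
eval-varPlus j c x = cong (_+ c) (dot-indicator j _ x on-j off-j)
  where
  on-j : (if does (j Fin.≟ j) then + 1 else + 0) ≡ + 1
  on-j with j Fin.≟ j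
  ... | yes _   = refl
  ... | no  j≢j = contradiction refl j≢j
  off-j : ∀ k → k ≢ j → (if does (k Fin.≟ j) then + 1 else + 0) ≡ + 0
  off-j k k≢j with k Fin.≟ j
  ... | yes k≡j = contradiction k≡j k≢j
  ... | no  _   = refl

eval-const : ∀ {d} (f : Lin d) x → (∀ k → coeff f k ≡ + 0) → eval f x ≡ const f
eval-const f x f≡0 = trans (cong (_+ const f) (dot-zeroˡ (coeffs f) x f≡0)) (ℤ.+-identityˡ (const f))

dot-≡-mod : ∀ {n q} (a x y : Vec ℤ n) →
             (∀ k → lookup a k ≡ + 0 ⊎ (lookup x k ≡ lookup y k mod q)) → dot a x ≡ dot a y mod q
dot-≡-mod         []       []       []       _ = ≡-mod (Signed.divides (+ 0) refl)
dot-≡-mod {q = q} (a ∷ as) (x ∷ xs) (y ∷ ys) h = ≡-mod (subst (_ Signed.∣_)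
    (solve 5 (λ a x y s t → a :* (x :- y) :+ (s :- t) := (a :* x :+ s) :- (a :* y :+ t))
       refl a x y (dot as xs) (dot as ys))
    (∣m∣n⇒∣m+n (head (h zero)) (q∣a-b (dot-≡-mod as xs ys (λ k → h (suc k))))))
  where
  head : a ≡ + 0 ⊎ (x ≡ y mod q) → + q Signed.∣ a *ℤ (x - y)
  head (inj₁ refl)   = Signed.divides (+ 0) refl
  head (inj₂ (≡-mod q∣x-y)) = ∣n⇒∣m*n a q∣x-y

eval-≡-mod : ∀ {d q} (f : Lin d) (x y : Vec ℤ d) →
              (∀ k → coeff f k ≡ + 0 ⊎ (lookup x k ≡ lookup y k mod q)) → eval f x ≡ eval f y mod q
eval-≡-mod f x y h = ≡-mod
  (subst (_ Signed.∣_) (solve 3 (λ s t c → s :- t := (s :+ c) :- (t :+ c)) refl (dot (coeffs f) x) (dot (coeffs f) y) (const f))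
    (q∣a-b (dot-≡-mod (coeffs f) x y h)))

dot-nonNeg : ∀ {n} (a x : Vec ℤ n) → (∀ k → + 0 ≤ℤ lookup a k *ℤ lookup x k) → + 0 ≤ℤ dot a x
dot-nonNeg []       []       _ = +≤+ z≤n
dot-nonNeg (a ∷ as) (y ∷ ys) h = ℤ.+-mono-≤ (h zero) (dot-nonNeg as ys (λ k → h (suc k)))

eval-pos : ∀ {d} (f : Lin d) x → (∀ k → + 0 ≤ℤ coeff f k *ℤ lookup x k) → + 0 <ℤ const f →
           + 0 <ℤ eval f x
eval-pos f x h c>0 = ℤ.+-mono-≤-< (dot-nonNeg (coeffs f) x h) c>0

0≤i*+n : ∀ {i} n → + 0 ≤ℤ i → + 0 ≤ℤ i *ℤ + n
0≤i*+n {+ m} n _ = subst (+ 0 ≤ℤ_) (pos-* m n) (+≤+ z≤n)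

∣const∣≤normLin : ∀ {d} (f : Lin d) → ∣ const f ∣ ≤ normLin f
∣const∣≤normLin (mkLin cs c) = go cs
  where
  go : ∀ {n} (cs : Vec ℤ n) → ∣ c ∣ ≤ foldr (λ _ → ℕ) (λ a r → ∣ a ∣ ⊔ r) ∣ c ∣ cs
  go []       = ≤-refl
  go (a ∷ as) = ≤-trans (go as) (m≤n⊔m _ _)

≤-maxFin : ∀ {n} (g : Fin n → ℕ) i → g i ≤ maxFin g
≤-maxFin g zero    = m≤m⊔n _ _
≤-maxFin g (suc i) = ≤-trans (≤-maxFin (λ j → g (suc j)) i) (m≤n⊔m _ _)

normLin-lhs≤normSys : ∀ {d} (Ψ : System d) i → normLin (lhs Ψ i) ≤ normSys Ψ
normLin-lhs≤normSys Ψ i = ≤-trans (m≤m⊔n _ _) (≤-maxFin _ i)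

normLin-rhs≤normSys : ∀ {d} (Ψ : System d) i → normLin (rhs Ψ i) ≤ normSys Ψ
normLin-rhs≤normSys Ψ i = ≤-trans (m≤n⊔m _ _) (≤-maxFin _ i)

∣1-c∣≤∣c∣ : ∀ {c} → + 0 <ℤ c → ∣ + 1 - c ∣ ≤ ∣ c ∣
∣1-c∣≤∣c∣ {+ zero}      (+<+ ())
∣1-c∣≤∣c∣ {+ suc zero}    _ = z≤n
∣1-c∣≤∣c∣ {+ suc (suc n)} _ = n≤1+n _

n≤n^[1+k] : ∀ n k → n ≤ n ^ suc k
n≤n^[1+k] zero        k = z≤n
n≤n^[1+k] n@(suc _)   k = m≤m*n n (n ^ k) {{m^n≢0 n k}}

p*N≤bound : ∀ d p N → p * N ≤ suc d * N ^ 3 * p ^ 2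
p*N≤bound d p N = begin
  p * N                   ≤⟨ *-mono-≤ (n≤n^[1+k] p 1) (n≤n^[1+k] N 2) ⟩
  p ^ 2 * N ^ 3           ≡⟨ *-comm (p ^ 2) (N ^ 3) ⟩
  N ^ 3 * p ^ 2           ≤⟨ m≤n*m (N ^ 3 * p ^ 2) (suc d) ⟩
  suc d * (N ^ 3 * p ^ 2) ≡⟨ *-assoc (suc d) (N ^ 3) (p ^ 2) ⟨
  suc d * N ^ 3 * p ^ 2   ∎
  where open ≤-Reasoning

_≟ₖ_ : DecidableEquality VarKind
Z ≟ₖ Z = yes refl
Z ≟ₖ Y = no (λ ())
Z ≟ₖ W = no (λ ())
Y ≟ₖ Z = no (λ ())
Y ≟ₖ Y = yes refl
Y ≟ₖ W = no (λ ())
W ≟ₖ Z = no (λ ())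
W ≟ₖ Y = no (λ ())
W ≟ₖ W = yes refl

onlyKind-split : ∀ {d} {kind : Fin d → VarKind} {κ} f → OnlyKind kind κ f →
                 ∀ k → coeff f k ≡ + 0 ⊎ kind k ≡ κ
onlyKind-split {kind = kind} {κ} f only k with kind k ≟ₖ κ
... | yes kind≡κ = inj₂ kind≡κ
... | no  kind≢κ = inj₁ (only k kind≢κ)

onlyKind-kind : ∀ {d} {kind : Fin d → VarKind} {κ k} f → OnlyKind kind κ f → coeff f k ≢ + 0 →
                kind k ≡ κ
onlyKind-kind {k = k} f only coeff≢0 with onlyKind-split f only k
... | inj₁ coeff≡0 = contradiction coeff≡0 coeff≢0
... | inj₂ kind≡κ  = kind≡κ

-- The small solution

module Construction
  {d d′} {Ψ : System d} {u : Vec ℤ d′} {E : Vec (Vec ℤ d) d′} {kind : Fin d → VarKind}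
  (conds : GcdToDivConds Ψ u E kind) {p : ℕ} (1<p : 1 < p) (b : Vec ℤ d) (b-sol : SolModP Ψ p b)
  where

  open GcdToDivConds conds
  open Valuation 1<p

  N : ℕ
  N = normSys Ψ

  K : ℕ
  K = proj₁ (power-above N)

  M : ℕ
  M = p ^ K

  N<M : N < M
  N<M = proj₁ (proj₂ (power-above N))

  M≤1+pN : M ≤ suc (p * N)
  M≤1+pN = proj₂ (proj₂ (power-above N))

  N≤pN : N ≤ p * N
  N≤pN = m≤n*m N p

  instance
    M≢0 : NonZero M
    M≢0 = m^n≢0 p K

  ∣lhs-const∣≤N : ∀ i → ∣ const (lhs Ψ i) ∣ ≤ N
  ∣lhs-const∣≤N i = ≤-trans (∣const∣≤normLin (lhs Ψ i)) (normLin-lhs≤normSys Ψ i)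

  ∣rhs-const∣≤N : ∀ i → ∣ const (rhs Ψ i) ∣ ≤ N
  ∣rhs-const∣≤N i = ≤-trans (∣const∣≤normLin (rhs Ψ i)) (normLin-rhs≤normSys Ψ i)

  lhs-b≢0 : ∀ i → eval (lhs Ψ i) b ≢ + 0
  lhs-b≢0 i = proj₁ (b-sol i)

  lhs-b≼rhs-b : ∀ i → PowDivides (eval (lhs Ψ i) b) (eval (rhs Ψ i) b)
  lhs-b≼rhs-b i = ValLe⇒powDivides (lhs-b≢0 i) (proj₂ (b-sol i))

  vₚ : Fin (m Ψ) → ℕ
  vₚ i = proj₁ (valuation (lhs-b≢0 i))

  vₚ-hasVal : ∀ i → HasVal p (eval (lhs Ψ i) b) (vₚ i)
  vₚ-hasVal i = proj₂ (valuation (lhs-b≢0 i))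

  record ZShape (z : Fin d) : Set where
    field
      c     : ℤ
      c>0   : + 0 <ℤ c
      ∣c∣≤N : ∣ c ∣ ≤ N
      lhs≡  : ∀ i → coeff (lhs Ψ i) z ≢ + 0 → lhs Ψ i ≡ varPlus z c

  zShape : ∀ {z} → kind z ≡ Z → ZShape z
  zShape {z} e with zVars z e
  ... | c , c>0 , lhs≡ , _ , (i , _ , _ , lhs-i≡ , _) = record
    { c     = c
    ; c>0   = c>0
    ; ∣c∣≤N = subst (λ f → ∣ const f ∣ ≤ N) lhs-i≡ (∣lhs-const∣≤N i)
    ; lhs≡  = lhs≡
    }

  record WShape (w : Fin d) : Set where
    field
      c       : ℤ
      c>0     : + 0 <ℤ c
      ∣c∣≤N   : ∣ c ∣ ≤ N
      rhs≡    : ∀ i → coeff (rhs Ψ i) w ≢ + 0 → rhs Ψ i ≡ varPlus w (+ 0) ⊎ rhs Ψ i ≡ varPlus w c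
      i₀ i₁   : Fin (m Ψ)
      rhs-i₀  : rhs Ψ i₀ ≡ varPlus w (+ 0)
      rhs-i₁  : rhs Ψ i₁ ≡ varPlus w c
      only-i₀ : ∀ i → rhs Ψ i ≡ varPlus w (+ 0) → i ≡ i₀
      only-i₁ : ∀ i → rhs Ψ i ≡ varPlus w c → i ≡ i₁

  wShape : ∀ {w} → kind w ≡ W → WShape w
  wShape {w} e with wVars w e
  ... | c , c>0 , _ , rhs≡ , (i₀ , rhs-i₀ , only-i₀) , (i₁ , rhs-i₁ , only-i₁) = record
    { c       = c
    ; c>0     = c>0
    ; ∣c∣≤N   = subst (λ f → ∣ const f ∣ ≤ N) rhs-i₁ (∣rhs-const∣≤N i₁)
    ; rhs≡    = rhs≡
    ; i₀      = i₀
    ; i₁      = i₁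
    ; rhs-i₀  = rhs-i₀
    ; rhs-i₁  = rhs-i₁
    ; only-i₀ = only-i₀
    ; only-i₁ = only-i₁
    }

  module WVar {w : Fin d} (e : kind w ≡ W) where
    open WShape (wShape e) public

    choice : ∃[ t ] ((t ≡ - c × vₚ i₀ ≤ vₚ i₁) ⊎ (t ≡ + 0 × vₚ i₁ < vₚ i₀))
    choice with vₚ i₀ ≤? vₚ i₁
    ... | yes v₀≤v₁ = - c , inj₁ (refl , v₀≤v₁)
    ... | no  v₀≰v₁ = + 0 , inj₂ (refl , ≰⇒> v₀≰v₁)

    value : ℤ
    value = proj₁ choice

    ∣value∣≤∣c∣ : ∣ value ∣ ≤ ∣ c ∣
    ∣value∣≤∣c∣ with proj₂ choice
    ... | inj₁ (value≡-c , _) = subst (λ t → ∣ t ∣ ≤ ∣ c ∣) (sym value≡-c) (≤-reflexive (∣-i∣≡∣i∣ c))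
    ... | inj₂ (value≡0 , _)  = subst (λ t → ∣ t ∣ ≤ ∣ c ∣) (sym value≡0) z≤n

  coordinate : (k : Fin d) (κ : VarKind) → kind k ≡ κ → ℤ
  coordinate k Z e = + 1 - ZShape.c (zShape e)
  coordinate k Y _ = + (lookup b k %ℕ M)
  coordinate k W e = WVar.value e

  b′ : Vec ℤ d
  b′ = tabulate (λ k → coordinate k (kind k) refl)

  lookup-b′ : ∀ k {κ} (e : kind k ≡ κ) → lookup b′ k ≡ coordinate k κ e
  lookup-b′ k refl = lookup∘tabulate _ k

  b′≡b-mod-M : ∀ {k} → kind k ≡ Y → lookup b′ k ≡ lookup b k mod M
  b′≡b-mod-M {k} e = ≡-mod (subst (+ M Signed.∣_) eq (∣m⇒∣-m (∣n⇒∣m*n q (Signed.∣-refl {+ M}))))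
    where
    r = lookup b k %ℕ M
    q = lookup b k /ℕ M
    eq : - (q *ℤ + M) ≡ lookup b′ k - lookup b k
    eq = begin
      - (q *ℤ + M)             ≡⟨ solve 3 (λ r q m → :- (q :* m) := r :- (r :+ q :* m)) refl (+ r) q (+ M) ⟩
      + r - (+ r + q *ℤ + M)   ≡⟨ cong₂ _-_ (sym (lookup-b′ k e)) (sym (a≡a%ℕn+[a/ℕn]*n (lookup b k) M)) ⟩
      lookup b′ k - lookup b k ∎
      where open ≡-Reasoning

  eval-b′≡b-mod-M : ∀ f → OnlyKind kind Y f → eval f b′ ≡ eval f b mod M
  eval-b′≡b-mod-M f only = eval-≡-mod f b′ b (λ k → map₂ b′≡b-mod-M (onlyKind-split f only k))

  eval-b′>0 : ∀ f → OnlyKind kind Y f → NonNeg f → + 0 <ℤ const f → + 0 <ℤ eval f b′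
  eval-b′>0 f only (coeff≥0 , _) c>0 = eval-pos f b′ term≥0 c>0
    where
    term≥0 : ∀ k → + 0 ≤ℤ coeff f k *ℤ lookup b′ k
    term≥0 k with onlyKind-split f only k
    ... | inj₁ coeff≡0 = subst (λ a → + 0 ≤ℤ a *ℤ lookup b′ k) (sym coeff≡0) (+≤+ z≤n)
    ... | inj₂ e       = subst (λ y → + 0 ≤ℤ coeff f k *ℤ y) (sym (lookup-b′ k e)) (0≤i*+n _ (coeff≥0 k))

  Satisfied : Fin (m Ψ) → Set
  Satisfied i = eval (lhs Ψ i) b′ ≢ + 0 × PowDivides (eval (lhs Ψ i) b′) (eval (rhs Ψ i) b′)

  satisfied-zLhs : ∀ i → OnlyKind kind Z (lhs Ψ i) → ∀ z → coeff (lhs Ψ i) z ≢ + 0 → Satisfied i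
  satisfied-zLhs i only z nz =
    subst (λ a → a ≢ + 0 × PowDivides a (eval (rhs Ψ i) b′)) (sym lhs-b′≡1) ((λ ()) , powDivides-one _)
    where
    e : kind z ≡ Z
    e = onlyKind-kind (lhs Ψ i) only nz
    open ZShape (zShape e)
    lhs-b′≡1 : eval (lhs Ψ i) b′ ≡ + 1
    lhs-b′≡1 = begin
      eval (lhs Ψ i) b′     ≡⟨ cong (λ f → eval f b′) (lhs≡ i nz) ⟩
      eval (varPlus z c) b′ ≡⟨ eval-varPlus z c b′ ⟩
      lookup b′ z + c       ≡⟨ cong (_+ c) (lookup-b′ z e) ⟩
      + 1 - c + c           ≡⟨ solve 1 (λ c → con (+ 1) :- c :+ c := con (+ 1)) refl c ⟩
      + 1                   ∎
      where open ≡-Reasoning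

  satisfied-constLhs : ∀ i → OnlyKind kind Y (rhs Ψ i) → (∀ k → coeff (lhs Ψ i) k ≡ + 0) → Satisfied i
  satisfied-constLhs i only coeff≡0 =
    subst (λ a → a ≢ + 0 × PowDivides a (eval (rhs Ψ i) b′)) (sym (eval-const (lhs Ψ i) b′ coeff≡0))
      (c≢0 , powDivides-resp-rhs {K} c≢0 (≤-<-trans (∣lhs-const∣≤N i) N<M)
                                        (eval-b′≡b-mod-M (rhs Ψ i) only) c≼rhs-b)
    where
    c≢0 : const (lhs Ψ i) ≢ + 0
    c≢0 = >0⇒≢0 (lhsPos i)
    c≼rhs-b : PowDivides (const (lhs Ψ i)) (eval (rhs Ψ i) b)
    c≼rhs-b = subst (λ a → PowDivides a _) (eval-const (lhs Ψ i) b coeff≡0) (lhs-b≼rhs-b i)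

  module WCase {w : Fin d} (e : kind w ≡ W) where
    open WVar e

    rhs-at : ∀ {i t} x → rhs Ψ i ≡ varPlus w t → eval (rhs Ψ i) x ≡ lookup x w + t
    rhs-at x rhs≡ = trans (cong (λ f → eval f x) rhs≡) (eval-varPlus w _ x)

    rhs-b′ : ∀ {i t} → rhs Ψ i ≡ varPlus w t → eval (rhs Ψ i) b′ ≡ value + t
    rhs-b′ {t = t} rhs≡ = trans (rhs-at b′ rhs≡) (cong (_+ t) (lookup-b′ w e))

    -- p^u divides both w and w + c at b, hence their difference c.
    pᵘ∣c : ∀ {u} → u ≤ vₚ i₀ → u ≤ vₚ i₁ → p ^ u ∣ ∣ c ∣
    pᵘ∣c u≤v₀ u≤v₁ = pow∣-offset (vₚ-hasVal i₀) (vₚ-hasVal i₁) u≤v₀ u≤v₁ lhs₀≼w lhs₁≼w+c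
      where
      lhs₀≼w : PowDivides (eval (lhs Ψ i₀) b) (lookup b w)
      lhs₀≼w = subst (PowDivides _) (trans (rhs-at b rhs-i₀) (+-identityʳ _)) (lhs-b≼rhs-b i₀)
      lhs₁≼w+c : PowDivides (eval (lhs Ψ i₁) b) (lookup b w + c)
      lhs₁≼w+c = subst (PowDivides _) (rhs-at b rhs-i₁) (lhs-b≼rhs-b i₁)

    satisfied-wRhs : ∀ i → OnlyKind kind Y (lhs Ψ i) → coeff (rhs Ψ i) w ≢ + 0 → Satisfied i
    satisfied-wRhs i only nz =
      >0⇒≢0 (eval-b′>0 (lhs Ψ i) only (lhsNonNeg i) (lhsPos i)) , by-cases (rhs≡ i nz) (proj₂ choice)
      where
      c≢0 : c ≢ + 0
      c≢0 = >0⇒≢0 c>0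
      moved : ∀ {j} → i ≡ j → ∣ eval (rhs Ψ i) b′ ∣ ≡ ∣ c ∣ → PowDivides (eval (lhs Ψ j) b) c →
              PowDivides (eval (lhs Ψ i) b′) (eval (rhs Ψ i) b′)
      moved refl ∣rhs∣≡∣c∣ a≼c = powDivides-resp-∣∣ (sym ∣rhs∣≡∣c∣)
        (powDivides-resp-lhs {K} (lhs-b≢0 i) c≢0 (≤-<-trans ∣c∣≤N N<M) (eval-b′≡b-mod-M (lhs Ψ i) only) a≼c)
      vanishing : eval (rhs Ψ i) b′ ≡ + 0 → PowDivides (eval (lhs Ψ i) b′) (eval (rhs Ψ i) b′)
      vanishing rhs≡0 = subst (PowDivides _) (sym rhs≡0) (powDivides-zero _)
      by-cases : rhs Ψ i ≡ varPlus w (+ 0) ⊎ rhs Ψ i ≡ varPlus w c →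
                 (value ≡ - c × vₚ i₀ ≤ vₚ i₁) ⊎ (value ≡ + 0 × vₚ i₁ < vₚ i₀) →
                 PowDivides (eval (lhs Ψ i) b′) (eval (rhs Ψ i) b′)
      by-cases (inj₁ r) (inj₁ (value≡-c , v₀≤v₁)) =
        moved (only-i₀ i r)
          (trans (cong ∣_∣ (trans (rhs-b′ r) (trans (+-identityʳ _) value≡-c))) (∣-i∣≡∣i∣ c))
          (hasVal⇒powDivides (vₚ i₀) (vₚ-hasVal i₀) (pᵘ∣c ≤-refl v₀≤v₁))
      by-cases (inj₁ r) (inj₂ (value≡0 , _)) =
        vanishing (trans (rhs-b′ r) (cong (_+ + 0) value≡0))
      by-cases (inj₂ r) (inj₁ (value≡-c , _)) =
        vanishing (trans (rhs-b′ r) (trans (cong (_+ c) value≡-c) (ℤ.+-inverseˡ c)))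
      by-cases (inj₂ r) (inj₂ (value≡0 , v₁<v₀)) =
        moved (only-i₁ i r)
          (cong ∣_∣ (trans (rhs-b′ r) (trans (cong (_+ c) value≡0) (ℤ.+-identityˡ c))))
          (hasVal⇒powDivides (vₚ i₁) (vₚ-hasVal i₁) (pᵘ∣c (<⇒≤ v₁<v₀) ≤-refl))

  satisfied : ∀ i → Satisfied i
  satisfied i with shape i
  ... | inj₂ (only , onlyW , w , nz) = WCase.satisfied-wRhs (onlyKind-kind (rhs Ψ i) onlyW nz) i only nz
  ... | inj₁ (onlyZ , onlyY) with any? (λ k → ¬? (coeff (lhs Ψ i) k ℤ.≟ + 0))
  ...   | yes (z , nz) = satisfied-zLhs i onlyZ z nz
  ...   | no  none     = satisfied-constLhs i onlyY
                           (λ k → decidable-stable (coeff (lhs Ψ i) k ℤ.≟ + 0) (λ nz → none (k , nz)))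

  b′-sol : SolModP Ψ p b′
  b′-sol i = proj₁ (satisfied i) , powDivides⇒ValLe (proj₂ (satisfied i))

  coordinate≤pN : ∀ k κ (e : kind k ≡ κ) → ∣ coordinate k κ e ∣ ≤ p * N
  coordinate≤pN k Z e = ≤-trans (∣1-c∣≤∣c∣ c>0) (≤-trans ∣c∣≤N N≤pN)
    where open ZShape (zShape e)
  coordinate≤pN k Y _ = m<1+n⇒m≤n (<-≤-trans (n%ℕd<d (lookup b k) M) M≤1+pN)
  coordinate≤pN k W e = ≤-trans ∣value∣≤∣c∣ (≤-trans ∣c∣≤N N≤pN)
    where open WVar e

  b′-norm : NormLe b′ (p * N)
  b′-norm k = subst (λ t → ∣ t ∣ ≤ p * N) (sym (lookup-b′ k refl)) (coordinate≤pN k (kind k) refl)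

lemma11 : ∀ {d d'} (Ψ : System d) (u : Vec ℤ d') (E : Vec (Vec ℤ d) d') (p : ℕ)
    → IsGcdToDiv Ψ u E
    → Prime p
    → InPΨ Ψ p
    → ∃[ b ] SolModP Ψ p b
    → ∃[ bp ] (SolModP Ψ p bp
    × NormLe bp (suc d * (normSys Ψ ^ 3) * (p ^ 2)))
lemma11 {d} Ψ u E p (kind , conds) p-prime _ (b , b-sol) =
  b′ , b′-sol , λ k → ≤-trans (b′-norm k) (p*N≤bound d p (normSys Ψ))
  where open Construction conds (nonTrivial⇒n>1 p {{prime⇒nonTrivial p-prime}}) b b-sol
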